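{- Let $m$ and $p$ be odd integers with $p/2 < m < p$. Then there exist natural numbers $s \leq \log_2(p)$ and $t < p/2$ such that $$2^s t = (2^{s-1}-1)p + m.$$ -}

module Defs where

-- Write d = p − m as 2^k u with u odd; d > 0, and d < p/2 because m > p/2.
-- Since p and u are odd, t := (p − u)/2 is a natural number below p/2, and
-- 2^(k+1) t = 2^k p − 2^k u = 2^k p − (p − m) = (2^k − 1) p + m, so s := k + 1 works.
module Submission where

open import Defs
open import Data.Nat using (ℕ; _∸_; _≤_) renaming (_^_ to _^ℕ_)
open import Data.Nat.Logarithm using (⌊log₂_⌋)
open import Data.Integer using (ℤ; +_; _+_; _-_; _*_; _<_; ∣_∣)
open import Data.Integer.Divisibility using (_∣_)
open import Data.Product using (∃-syntax; _×_)
open import Relation.Nullary using (¬_)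
open import Relation.Binary.PropositionalEquality using (_≡_)

open import Data.Nat as ℕ using (zero; suc; z≤n; s≤s)
import Data.Nat.Properties as ℕ
import Data.Nat.Divisibility as ℕ
open import Data.Nat.Induction using (<-rec)
open import Data.Nat.Logarithm using (⌊log₂[2^n]⌋≡n; ⌊log₂⌋-mono-≤)
open import Data.Nat.Tactic.RingSolver using (solve-∀)
open import Data.Integer using (-[1+_]; +<+)
import Data.Integer.Properties as ℤ
import Data.Integer.Tactic.RingSolver as ℤ
open import Data.Product using (_,_)
open import Data.Empty using (⊥-elim)
open import Function using (_∘_)
open import Relation.Nullary using (yes; no)
open import Relation.Binary.PropositionalEquality
  using (refl; sym; trans; cong; subst; module ≡-Reasoning)

¬2∣n⇒∃[q]n≡1+2q : ∀ n → ¬ (2 ℕ.∣ n) → ∃[ q ] n ≡ suc (2 ℕ.* q)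
¬2∣n⇒∃[q]n≡1+2q zero ¬2∣0 = ⊥-elim (¬2∣0 (2 ℕ.∣0))
¬2∣n⇒∃[q]n≡1+2q (suc zero) _ = 0 , refl
¬2∣n⇒∃[q]n≡1+2q (suc (suc n)) ¬2∣2+n
  with q , n≡1+2q ← ¬2∣n⇒∃[q]n≡1+2q n (¬2∣2+n ∘ ℕ.∣m∣n⇒∣m+n ℕ.∣-refl)
  = suc q , cong suc (trans (cong suc n≡1+2q) (sym (ℕ.*-suc 2 q)))

0<n⇒∃[k,v]n≡2^k*[1+2v] : ∀ n → 0 ℕ.< n → ∃[ k ] ∃[ v ] n ≡ (2 ^ℕ k) ℕ.* suc (2 ℕ.* v)
0<n⇒∃[k,v]n≡2^k*[1+2v] = <-rec _ split
  where
  split : ∀ n → (∀ {q} → q ℕ.< n → 0 ℕ.< q → ∃[ k ] ∃[ v ] q ≡ (2 ^ℕ k) ℕ.* suc (2 ℕ.* v)) →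
          0 ℕ.< n → ∃[ k ] ∃[ v ] n ≡ (2 ^ℕ k) ℕ.* suc (2 ℕ.* v)
  split n _   0<n with 2 ℕ.∣? n
  split n _   0<n | no ¬2∣n with v , n≡1+2v ← ¬2∣n⇒∃[q]n≡1+2q n ¬2∣n =
    0 , v , trans n≡1+2v (sym (ℕ.+-identityʳ _))
  split n _   ()  | yes (ℕ.divides zero refl)
  split n rec 0<n | yes (ℕ.divides q@(suc _) n≡q*2)
    with k , v , q≡2^k*u ← rec (subst (q ℕ.<_) (sym n≡q*2) (ℕ.m<m*n q 2 ℕ.≤-refl)) (s≤s z≤n) =
    suc k , v , (begin
      n                                     ≡⟨ trans n≡q*2 (ℕ.*-comm q 2) ⟩
      2 ℕ.* q                               ≡⟨ cong (2 ℕ.*_) q≡2^k*u ⟩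
      2 ℕ.* ((2 ^ℕ k) ℕ.* suc (2 ℕ.* v))    ≡⟨ ℕ.*-assoc 2 (2 ^ℕ k) _ ⟨
      (2 ^ℕ suc k) ℕ.* suc (2 ℕ.* v)        ∎)
    where open ≡-Reasoning

-- The witness is t = (b − u)/2 for b = 1 + 2β and u = 1 + 2v.
1+2v≤1+2β⇒∃[t]2^[1+k]*t+2^k*[1+2v]≡2^k*[1+2β] : ∀ k {v β} → suc (2 ℕ.* v) ≤ suc (2 ℕ.* β) →
  ∃[ t ] 2 ℕ.* t ℕ.< suc (2 ℕ.* β)
       × (2 ^ℕ suc k) ℕ.* t ℕ.+ (2 ^ℕ k) ℕ.* suc (2 ℕ.* v) ≡ (2 ^ℕ k) ℕ.* suc (2 ℕ.* β)
1+2v≤1+2β⇒∃[t]2^[1+k]*t+2^k*[1+2v]≡2^k*[1+2β] k {v} {β} u≤b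
  with w , refl ← ℕ.m≤n⇒∃[o]m+o≡n {v} {β} (ℕ.*-cancelˡ-≤ 2 (ℕ.s≤s⁻¹ u≤b)) =
  w , s≤s (ℕ.*-monoʳ-≤ 2 (ℕ.m≤n+m w v)) , identity (2 ^ℕ k) v w
  where
  identity : ∀ P v w → 2 ℕ.* P ℕ.* w ℕ.+ P ℕ.* suc (2 ℕ.* v) ≡ P ℕ.* suc (2 ℕ.* (v ℕ.+ w))
  identity = solve-∀

a+d≡b<2a⇒2d<b : ∀ {a b} d → a ℕ.+ d ≡ b → b ℕ.< 2 ℕ.* a → 2 ℕ.* d ℕ.< b
a+d≡b<2a⇒2d<b {a} {b} d a+d≡b b<2a =
  ℕ.+-cancelˡ-< b (2 ℕ.* d) b (subst (b ℕ.+ 2 ℕ.* d ℕ.<_) 2a+2d≡b+b (ℕ.+-monoˡ-< (2 ℕ.* d) b<2a))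
  where
  2a+2d≡b+b : 2 ℕ.* a ℕ.+ 2 ℕ.* d ≡ b ℕ.+ b
  2a+2d≡b+b = trans (sym (ℕ.*-distribˡ-+ 2 a d)) (trans (cong (2 ℕ.*_) a+d≡b) (cong (b ℕ.+_) (ℕ.+-identityʳ b)))

2^k≤d∧2d<b⇒1+k≤log₂b : ∀ {k d b} → 2 ^ℕ k ≤ d → 2 ℕ.* d ℕ.< b → suc k ≤ ⌊log₂ b ⌋
2^k≤d∧2d<b⇒1+k≤log₂b {k} {d} {b} 2^k≤d 2d<b = subst (_≤ ⌊log₂ b ⌋) (⌊log₂[2^n]⌋≡n (suc k))
  (⌊log₂⌋-mono-≤ (ℕ.≤-trans (ℕ.*-monoʳ-≤ 2 2^k≤d) (ℕ.<⇒≤ 2d<b)))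

lemma2p3-ℕ : ∀ a b → ¬ (2 ℕ.∣ b) → b ℕ.< 2 ℕ.* a → a ℕ.< b →
  ∃[ k ] ∃[ t ] suc k ≤ ⌊log₂ b ⌋ × 2 ℕ.* t ℕ.< b
              × (2 ^ℕ suc k) ℕ.* t ℕ.+ b ≡ (2 ^ℕ k) ℕ.* b ℕ.+ a
lemma2p3-ℕ a b ¬2∣b b<2a a<b
  with d-1 , 1+a+d-1≡b ← ℕ.m≤n⇒∃[o]m+o≡n a<b
  with k , v , d≡2^k*u ← 0<n⇒∃[k,v]n≡2^k*[1+2v] (suc d-1) (s≤s z≤n)
  with β , refl ← ¬2∣n⇒∃[q]n≡1+2q b ¬2∣b
  = conclude (1+2v≤1+2β⇒∃[t]2^[1+k]*t+2^k*[1+2v]≡2^k*[1+2β] k {v} {β} u≤b)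
  where
  open ≡-Reasoning
  d : ℕ
  d = suc d-1
  a+d≡b : a ℕ.+ d ≡ b
  a+d≡b = trans (ℕ.+-suc a d-1) 1+a+d-1≡b
  u≤b : suc (2 ℕ.* v) ≤ b
  u≤b = ℕ.≤-trans (subst (suc (2 ℕ.* v) ≤_) (sym d≡2^k*u) (ℕ.m≤n*m _ (2 ^ℕ k) {{ℕ.m^n≢0 2 k}}))
                  (subst (d ≤_) a+d≡b (ℕ.m≤n+m d a))
  2^k≤d : 2 ^ℕ k ≤ d
  2^k≤d = subst (2 ^ℕ k ≤_) (sym d≡2^k*u) (ℕ.m≤m*n (2 ^ℕ k) (suc (2 ℕ.* v)))
  conclude : ∃[ t ] 2 ℕ.* t ℕ.< b × (2 ^ℕ suc k) ℕ.* t ℕ.+ (2 ^ℕ k) ℕ.* suc (2 ℕ.* v) ≡ (2 ^ℕ k) ℕ.* b →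
             ∃[ k ] ∃[ t ] suc k ≤ ⌊log₂ b ⌋ × 2 ℕ.* t ℕ.< b
                         × (2 ^ℕ suc k) ℕ.* t ℕ.+ b ≡ (2 ^ℕ k) ℕ.* b ℕ.+ a
  conclude (t , 2t<b , halving) =
    k , t , 2^k≤d∧2d<b⇒1+k≤log₂b 2^k≤d (a+d≡b<2a⇒2d<b d a+d≡b b<2a) , 2t<b , (begin
      (2 ^ℕ suc k) ℕ.* t ℕ.+ b                                ≡⟨ cong ((2 ^ℕ suc k) ℕ.* t ℕ.+_) (trans (sym a+d≡b) (ℕ.+-comm a d)) ⟩
      (2 ^ℕ suc k) ℕ.* t ℕ.+ (d ℕ.+ a)                        ≡⟨ ℕ.+-assoc _ d a ⟨
      (2 ^ℕ suc k) ℕ.* t ℕ.+ d ℕ.+ a                          ≡⟨ cong (λ x → (2 ^ℕ suc k) ℕ.* t ℕ.+ x ℕ.+ a) d≡2^k*u ⟩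
      (2 ^ℕ suc k) ℕ.* t ℕ.+ (2 ^ℕ k) ℕ.* suc (2 ℕ.* v) ℕ.+ a ≡⟨ cong (ℕ._+ a) halving ⟩
      (2 ^ℕ k) ℕ.* b ℕ.+ a                                    ∎)

i+k≡j*k+l⇒i≡[j-1]*k+l : ∀ i j k l → i + k ≡ j * k + l → i ≡ (j - + 1) * k + l
i+k≡j*k+l⇒i≡[j-1]*k+l i j k l eq = begin
  i                   ≡⟨ i≡[i+k]-k i k ⟩
  (i + k) - k         ≡⟨ cong (_- k) eq ⟩
  (j * k + l) - k     ≡⟨ [j*k+l]-k≡[j-1]*k+l j k l ⟩
  (j - + 1) * k + l   ∎
  where
  open ≡-Reasoning
  i≡[i+k]-k : ∀ i k → i ≡ (i + k) - k
  i≡[i+k]-k = ℤ.solve-∀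
  [j*k+l]-k≡[j-1]*k+l : ∀ j k l → (j * k + l) - k ≡ (j - + 1) * k + l
  [j*k+l]-k≡[j-1]*k+l = ℤ.solve-∀

lemma2p3 : (m p : ℤ) → ¬ (+ 2 ∣ m) → ¬ (+ 2 ∣ p) → p < + 2 * m → m < p →
    ∃[ s ] ∃[ t ] (s ≤ ⌊log₂ ∣ p ∣ ⌋ × + 2 * + t < p
    × + (2 ^ℕ s) * + t ≡ (+ (2 ^ℕ (s ∸ 1)) - + 1) * p + m)
lemma2p3 (+ a) (+ b) _ ¬2∣b p<2m (+<+ a<b)
  with k , t , log-bound , 2t<b , eq ← lemma2p3-ℕ a b ¬2∣b (ℤ.drop‿+<+ (subst (+ b <_) (sym (ℤ.pos-* 2 a)) p<2m)) a<b =
  suc k , t , log-bound , subst (_< + b) (ℤ.pos-* 2 t) (+<+ 2t<b) ,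
  i+k≡j*k+l⇒i≡[j-1]*k+l (+ (2 ^ℕ suc k) * + t) (+ (2 ^ℕ k)) (+ b) (+ a) (begin
    + (2 ^ℕ suc k) * + t + + b     ≡⟨ cong (_+ + b) (ℤ.pos-* (2 ^ℕ suc k) t) ⟨
    + ((2 ^ℕ suc k) ℕ.* t) + + b   ≡⟨ ℤ.pos-+ _ b ⟨
    + ((2 ^ℕ suc k) ℕ.* t ℕ.+ b)   ≡⟨ cong +_ eq ⟩
    + ((2 ^ℕ k) ℕ.* b ℕ.+ a)       ≡⟨ ℤ.pos-+ _ a ⟩
    + ((2 ^ℕ k) ℕ.* b) + + a       ≡⟨ cong (_+ + a) (ℤ.pos-* (2 ^ℕ k) b) ⟩
    + (2 ^ℕ k) * + b + + a         ∎)
  where open ≡-Reasoning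
lemma2p3 (+ a) -[1+ y ] _ _ _ ()
lemma2p3 -[1+ x ] p _ _ p<2m m<p =
  ⊥-elim (2≮1 (ℤ.*-cancelʳ-<-neg x (subst (_< + 2 * -[1+ x ]) (sym (ℤ.*-identityˡ -[1+ x ])) (ℤ.<-trans m<p p<2m))))
  where
  2≮1 : ¬ (+ 2 < + 1)
  2≮1 (+<+ (s≤s ()))
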